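{- For each integer $k\ge 1$, let $V_k(x)=\sum_{n\ge 1} v_k(n)x^n$, where $v_k(n)$ is the total number of vertices having exactly $k$ vertices in their subtree, summed over all Motzkin trees with $n$ vertices. Let $R_k(x)=\sum_{n\ge1} r_k(n)x^n$, where $r_k(n)$ is the number of Motzkin trees with $n$ vertices whose root has exactly $k$ vertices in its subtree. Then, as formal power series, $$V_k(x)=\frac{R_k(x)}{\sqrt{1-2x-3x^2}}.$$
   Context: A Motzkin tree is a rooted planar (ordered) tree in which every non-leaf vertex has either one or two children; its size is its number of vertices. The subtree of a vertex $v$ consists of $v$ together with all of its descendants (so a leaf has exactly $1$ vertex in its subtree). The square root denotes the formal power series with constant term $1$. -}

module Defs where

open import Data.Nat using (ℕ; zero; suc; _≟_)
open import Data.Integer using (ℤ; +_; -_) renaming (_+_ to _+ℤ_; _*_ to _*ℤ_)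
open import Data.List using (List; []; _∷_; _++_; map; concatMap; filter; length; upTo; foldr)
open import Data.Nat.ListAction using (sum)
open import Relation.Nullary.Decidable using (does)
open import Data.Bool using (if_then_else_)
open import Relation.Binary.PropositionalEquality using (_≡_)
open import Data.Product using (_×_)

data Motzkin : Set where
  leaf   : Motzkin
  unary  : Motzkin → Motzkin
  binary : Motzkin → Motzkin → Motzkin

size : Motzkin → ℕ
size leaf         = 1
size (unary t)    = suc (size t)
size (binary l r) = suc (size l Data.Nat.+ size r)

-- all Motzkin trees of height ≤ d (height of a leaf is 1), each listed once
treesOfHeight≤ : ℕ → List Motzkin
treesOfHeight≤ zero    = []
treesOfHeight≤ (suc d) =
  leaf ∷ (map unary (treesOfHeight≤ d)
          ++ concatMap (λ l → map (binary l) (treesOfHeight≤ d)) (treesOfHeight≤ d))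

-- all Motzkin trees with exactly n vertices (such trees have height ≤ n)
treesOfSize : ℕ → List Motzkin
treesOfSize n = filter (λ t → size t ≟ n) (treesOfHeight≤ n)

ind : ℕ → ℕ → ℕ
ind m k = if does (m ≟ k) then 1 else 0

countSub : ℕ → Motzkin → ℕ
countSub k leaf         = ind 1 k
countSub k (unary t)    = ind (size (unary t)) k Data.Nat.+ countSub k t
countSub k (binary l r) = ind (size (binary l r)) k Data.Nat.+ (countSub k l Data.Nat.+ countSub k r)

v : ℕ → ℕ → ℕ
v k n = sum (map (countSub k) (treesOfSize n))

r : ℕ → ℕ → ℕ
r k n = length (filter (λ t → size t ≟ k) (treesOfSize n))

Series : Set
Series = ℕ → ℤ

_⊛_ : Series → Series → Series
(f ⊛ g) n = foldr _+ℤ_ (+ 0) (map (λ i → f i *ℤ g (n Data.Nat.∸ i)) (upTo (suc n)))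

V : ℕ → Series
V k n = + (v k n)

R : ℕ → Series
R k n = + (r k n)

P : Series
P zero                  = + 1
P (suc zero)            = - (+ 2)
P (suc (suc zero))      = - (+ 3)
P (suc (suc (suc _)))   = + 0

IsSqrtP : Series → Set
IsSqrtP S = (S 0 ≡ + 1) × (∀ n → (S ⊛ S) n ≡ P n)

-- Removing the root of a Motzkin tree with n + 1 vertices leaves either one subtree with n vertices
-- or an ordered pair of subtrees with i + j = n vertices. Summed over all trees this gives
-- M = x(1 + M + M²) for the Motzkin series M and, since every vertex other than the root lies in a
-- subtree of the root, V = R + x(V + 2VM) for the vertex series. By the first identity 1 - x - 2xM
-- squares to 1 - 2x - 3x², and it is the only square root with constant term 1 because power series
-- over ℤ have no zero divisors; the second identity says exactly V(1 - x - 2xM) = R.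

module Submission where

open import Defs
open import Data.Nat using (ℕ; _≥_)
open import Data.Product using (Σ; _×_)
open import Relation.Binary.PropositionalEquality using (_≡_)

open import Data.Bool using (true; false)
open import Data.Integer using (ℤ; +_; -_; _+_; _-_; _*_; 0ℤ; 1ℤ)
open import Data.Integer.Properties
  using ( +-identityˡ; +-identityʳ; +-comm; +-assoc; +-inverseʳ; +-commutativeSemigroup
        ; *-identityˡ; *-identityʳ; *-zeroʳ; *-comm; *-assoc; *-distribˡ-+; *-distribʳ-+
        ; i*j≡0⇒i≡0∨j≡0; i-j≡0⇒i≡j)
open import Data.Integer.Tactic.RingSolver using (solve-∀)
open import Data.List using (List; []; _∷_; _++_; map; concatMap; filter; length; foldr; applyUpTo)
open import Data.Nat as ℕ using (zero; suc; _≤_; _≤′_; _∸_; ≤′-refl; ≤′-step; s≤s; _≟_)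
open import Data.Nat.ListAction using (sum)
open import Data.Nat.Properties
  using (≤⇒≤′; ≤′⇒≤; m+n≤o⇒m≤o; m+n≤o⇒n≤o; ≤-trans; ≤-reflexive; ≤-refl; m≤n⇒m<n∨m≡n)
open import Data.Product using (_,_)
open import Data.Sum using (inj₁; inj₂)
open import Function using (_∘_; flip; id)
open import Relation.Nullary.Decidable using (does)
open import Relation.Nullary.Negation using (contradiction)
open import Relation.Binary.PropositionalEquality
  using (refl; sym; trans; cong; cong₂; _≢_; _≗_; module ≡-Reasoning)

open import Algebra.Properties.CommutativeSemigroup +-commutativeSemigroup
  using () renaming (interchange to +-interchange)
open ≡-Reasoning

-- Antidiagonal sums and the Cauchy product

antidiagonalSum : ℕ → (ℕ → ℕ → ℤ) → ℤ
antidiagonalSum zero    h = h 0 0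
antidiagonalSum (suc n) h = h 0 (suc n) + antidiagonalSum n (λ i j → h (suc i) j)

antidiagonalSum-cong : ∀ n {h g : ℕ → ℕ → ℤ} →
  (∀ i j → i ℕ.+ j ≡ n → h i j ≡ g i j) → antidiagonalSum n h ≡ antidiagonalSum n g
antidiagonalSum-cong zero    h≡g = h≡g 0 0 refl
antidiagonalSum-cong (suc n) h≡g =
  cong₂ _+_ (h≡g 0 (suc n) refl) (antidiagonalSum-cong n (λ i j eq → h≡g (suc i) j (cong suc eq)))

antidiagonalSum-vanishing : ∀ n {h : ℕ → ℕ → ℤ} →
  (∀ i j → i ℕ.+ j ≡ n → h i j ≡ 0ℤ) → antidiagonalSum n h ≡ 0ℤ
antidiagonalSum-vanishing zero    h≡0 = h≡0 0 0 refl
antidiagonalSum-vanishing (suc n) h≡0 =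
  cong₂ _+_ (h≡0 0 (suc n) refl) (antidiagonalSum-vanishing n (λ i j eq → h≡0 (suc i) j (cong suc eq)))

antidiagonalSum-+ : ∀ n (h g : ℕ → ℕ → ℤ) →
  antidiagonalSum n (λ i j → h i j + g i j) ≡ antidiagonalSum n h + antidiagonalSum n g
antidiagonalSum-+ zero    h g = refl
antidiagonalSum-+ (suc n) h g =
  trans (cong (_+_ (h 0 (suc n) + g 0 (suc n))) (antidiagonalSum-+ n h⁺ g⁺))
        (+-interchange (h 0 (suc n)) (g 0 (suc n)) (antidiagonalSum n h⁺) (antidiagonalSum n g⁺))
  where
  h⁺ g⁺ : ℕ → ℕ → ℤ
  h⁺ i j = h (suc i) j
  g⁺ i j = g (suc i) j

antidiagonalSum-- : ∀ n (h g : ℕ → ℕ → ℤ) →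
  antidiagonalSum n (λ i j → h i j - g i j) ≡ antidiagonalSum n h - antidiagonalSum n g
antidiagonalSum-- zero    h g = refl
antidiagonalSum-- (suc n) h g =
  trans (cong (_+_ (h 0 (suc n) - g 0 (suc n))) (antidiagonalSum-- n h⁺ g⁺))
        (interchange (h 0 (suc n)) (g 0 (suc n)) (antidiagonalSum n h⁺) (antidiagonalSum n g⁺))
  where
  h⁺ g⁺ : ℕ → ℕ → ℤ
  h⁺ i j = h (suc i) j
  g⁺ i j = g (suc i) j
  interchange : ∀ a b c d → (a - b) + (c - d) ≡ (a + c) - (b + d)
  interchange = solve-∀

antidiagonalSum-*ˡ : ∀ n c (h : ℕ → ℕ → ℤ) →
  antidiagonalSum n (λ i j → c * h i j) ≡ c * antidiagonalSum n h
antidiagonalSum-*ˡ zero    c h = refl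
antidiagonalSum-*ˡ (suc n) c h =
  trans (cong (_+_ (c * h 0 (suc n))) (antidiagonalSum-*ˡ n c (λ i j → h (suc i) j)))
    (sym (*-distribˡ-+ c (h 0 (suc n)) (antidiagonalSum n (λ i j → h (suc i) j))))

antidiagonalSum-*ʳ : ∀ n c (h : ℕ → ℕ → ℤ) →
  antidiagonalSum n (λ i j → h i j * c) ≡ antidiagonalSum n h * c
antidiagonalSum-*ʳ zero    c h = refl
antidiagonalSum-*ʳ (suc n) c h =
  trans (cong (_+_ (h 0 (suc n) * c)) (antidiagonalSum-*ʳ n c (λ i j → h (suc i) j)))
    (sym (*-distribʳ-+ c (h 0 (suc n)) (antidiagonalSum n (λ i j → h (suc i) j))))

antidiagonalSum-last : ∀ n (h : ℕ → ℕ → ℤ) →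
  antidiagonalSum (suc n) h ≡ antidiagonalSum n (λ i j → h i (suc j)) + h (suc n) 0
antidiagonalSum-last zero    h = refl
antidiagonalSum-last (suc n) h = begin
  h 0 (suc (suc n)) + antidiagonalSum (suc n) (λ i j → h (suc i) j)
    ≡⟨ cong (_+_ (h 0 (suc (suc n)))) (antidiagonalSum-last n (λ i j → h (suc i) j)) ⟩
  h 0 (suc (suc n)) + (antidiagonalSum n (λ i j → h (suc i) (suc j)) + h (suc (suc n)) 0)
    ≡⟨ sym (+-assoc (h 0 (suc (suc n))) _ _) ⟩
  (h 0 (suc (suc n)) + antidiagonalSum n (λ i j → h (suc i) (suc j))) + h (suc (suc n)) 0 ∎

antidiagonalSum-swap : ∀ n (h : ℕ → ℕ → ℤ) → antidiagonalSum n h ≡ antidiagonalSum n (flip h)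
antidiagonalSum-swap zero    h = refl
antidiagonalSum-swap (suc n) h = begin
  h 0 (suc n) + antidiagonalSum n (λ i j → h (suc i) j)
    ≡⟨ cong (_+_ (h 0 (suc n))) (antidiagonalSum-swap n (λ i j → h (suc i) j)) ⟩
  h 0 (suc n) + antidiagonalSum n (λ i j → h (suc j) i)
    ≡⟨ +-comm (h 0 (suc n)) _ ⟩
  antidiagonalSum n (λ i j → h (suc j) i) + h 0 (suc n)
    ≡⟨ sym (antidiagonalSum-last n (flip h)) ⟩
  antidiagonalSum (suc n) (flip h) ∎

infixl 7 _∗_

_∗_ : Series → Series → Series
(f ∗ g) n = antidiagonalSum n (λ i j → f i * g j)

map-applyUpTo : ∀ {A B : Set} (f : A → B) (g : ℕ → A) n → map f (applyUpTo g n) ≡ applyUpTo (f ∘ g) n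
map-applyUpTo f g zero    = refl
map-applyUpTo f g (suc n) = cong (f (g 0) ∷_) (map-applyUpTo f (g ∘ suc) n)

foldr-applyUpTo : ∀ n (h : ℕ → ℕ → ℤ) →
  foldr _+_ 0ℤ (applyUpTo (λ i → h i (n ∸ i)) (suc n)) ≡ antidiagonalSum n h
foldr-applyUpTo zero    h = +-identityʳ (h 0 0)
foldr-applyUpTo (suc n) h = cong (_+_ (h 0 (suc n))) (foldr-applyUpTo n (λ i j → h (suc i) j))

⊛≗∗ : ∀ f g → f ⊛ g ≗ f ∗ g
⊛≗∗ f g n = trans (cong (foldr _+_ 0ℤ) (map-applyUpTo (λ i → f i * g (n ∸ i)) id (suc n)))
                  (foldr-applyUpTo n (λ i j → f i * g j))

∗-comm : ∀ f g → f ∗ g ≗ g ∗ f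
∗-comm f g n = trans (antidiagonalSum-swap n _) (antidiagonalSum-cong n (λ i j _ → *-comm (f j) (g i)))

∗-congʳ : ∀ f {g h} → g ≗ h → f ∗ g ≗ f ∗ h
∗-congʳ f g≗h n = antidiagonalSum-cong n (λ i j _ → cong (f i *_) (g≗h j))

∗-distribˡ-- : ∀ f g h n → (f ∗ (λ j → g j - h j)) n ≡ (f ∗ g) n - (f ∗ h) n
∗-distribˡ-- f g h n = begin
  antidiagonalSum n (λ i j → f i * (g j - h j))
    ≡⟨ antidiagonalSum-cong n (λ i j _ → distrib (f i) (g j) (h j)) ⟩
  antidiagonalSum n (λ i j → f i * g j - f i * h j)
    ≡⟨ antidiagonalSum-- n _ _ ⟩
  (f ∗ g) n - (f ∗ h) n ∎
  where
  distrib : ∀ a b c → a * (b - c) ≡ a * b - a * c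
  distrib = solve-∀

∗-*ʳ : ∀ f c g n → (f ∗ (λ j → c * g j)) n ≡ c * (f ∗ g) n
∗-*ʳ f c g n = begin
  antidiagonalSum n (λ i j → f i * (c * g j))
    ≡⟨ antidiagonalSum-cong n (λ i j _ → commute (f i) c (g j)) ⟩
  antidiagonalSum n (λ i j → c * (f i * g j))
    ≡⟨ antidiagonalSum-*ˡ n c _ ⟩
  c * (f ∗ g) n ∎
  where
  commute : ∀ a b d → a * (b * d) ≡ b * (a * d)
  commute = solve-∀

∗-difference-of-squares : ∀ S T n →
  ((λ i → S i - T i) ∗ (λ j → S j + T j)) n ≡ (S ∗ S) n - (T ∗ T) n
∗-difference-of-squares S T n = begin
  antidiagonalSum n (λ i j → (S i - T i) * (S j + T j))
    ≡⟨ antidiagonalSum-cong n (λ i j _ → expand (S i) (S j) (T i) (T j)) ⟩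
  antidiagonalSum n (λ i j → (S i * S j - T i * T j) + (S i * T j - T i * S j))
    ≡⟨ antidiagonalSum-+ n _ _ ⟩
  antidiagonalSum n (λ i j → S i * S j - T i * T j) + antidiagonalSum n (λ i j → S i * T j - T i * S j)
    ≡⟨ cong₂ _+_ (antidiagonalSum-- n _ _) (antidiagonalSum-- n _ _) ⟩
  ((S ∗ S) n - (T ∗ T) n) + ((S ∗ T) n - (T ∗ S) n)
    ≡⟨ cong (λ c → ((S ∗ S) n - (T ∗ T) n) + ((S ∗ T) n - c)) (∗-comm T S n) ⟩
  ((S ∗ S) n - (T ∗ T) n) + ((S ∗ T) n - (S ∗ T) n)
    ≡⟨ cong (_+_ ((S ∗ S) n - (T ∗ T) n)) (+-inverseʳ ((S ∗ T) n)) ⟩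
  ((S ∗ S) n - (T ∗ T) n) + 0ℤ
    ≡⟨ +-identityʳ _ ⟩
  (S ∗ S) n - (T ∗ T) n ∎
  where
  expand : ∀ si sj ti tj → (si - ti) * (sj + tj) ≡ (si * sj - ti * tj) + (si * tj - ti * sj)
  expand = solve-∀

-- Written with ind so that the leaf indicator ind 1 (suc n) is definitionally 𝟙 n.
𝟙 : Series
𝟙 n = + ind 0 n

X· : Series → Series
X· f zero    = 0ℤ
X· f (suc n) = f n

X·-cong : ∀ {f g} → f ≗ g → X· f ≗ X· g
X·-cong f≗g zero    = refl
X·-cong f≗g (suc n) = f≗g n

∗-identityʳ : ∀ f → f ∗ 𝟙 ≗ f
∗-identityʳ f zero    = *-identityʳ (f 0)
∗-identityʳ f (suc n) = begin
  f 0 * 0ℤ + ((f ∘ suc) ∗ 𝟙) n ≡⟨ cong₂ _+_ (*-zeroʳ (f 0)) (∗-identityʳ (f ∘ suc) n) ⟩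
  0ℤ + f (suc n)                ≡⟨ +-identityˡ (f (suc n)) ⟩
  f (suc n)                     ∎

∗-X·ʳ : ∀ f g → f ∗ X· g ≗ X· (f ∗ g)
∗-X·ʳ f g zero    = *-zeroʳ (f 0)
∗-X·ʳ f g (suc n) = begin
  (f ∗ X· g) (suc n)                                  ≡⟨ antidiagonalSum-last n (λ i j → f i * X· g j) ⟩
  antidiagonalSum n (λ i j → f i * g j) + f (suc n) * 0ℤ ≡⟨ cong (_+_ ((f ∗ g) n)) (*-zeroʳ (f (suc n))) ⟩
  (f ∗ g) n + 0ℤ                                      ≡⟨ +-identityʳ _ ⟩
  (f ∗ g) n                                           ∎

∗-noZeroDivisors : ∀ D E → E 0 ≢ 0ℤ → D ∗ E ≗ (λ _ → 0ℤ) → D ≗ (λ _ → 0ℤ)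
∗-noZeroDivisors D E E0≢0 DE≡0 n = vanishesUpTo n n ≤-refl
  where
  cancelE0 : ∀ d → d * E 0 ≡ 0ℤ → d ≡ 0ℤ
  cancelE0 d eq with i*j≡0⇒i≡0∨j≡0 d eq
  ... | inj₁ d≡0  = d≡0
  ... | inj₂ E0≡0 = contradiction E0≡0 E0≢0

  vanishesUpTo : ∀ n i → i ≤ n → D i ≡ 0ℤ
  vanishesUpTo zero    zero    _ = cancelE0 (D 0) (DE≡0 0)
  vanishesUpTo (suc n) i i≤1+n with m≤n⇒m<n∨m≡n i≤1+n
  ... | inj₁ (s≤s i≤n) = vanishesUpTo n i i≤n
  ... | inj₂ refl      = cancelE0 (D (suc n)) (begin
    D (suc n) * E 0
      ≡⟨ sym (+-identityˡ _) ⟩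
    0ℤ + D (suc n) * E 0
      ≡⟨ cong (_+ D (suc n) * E 0) (sym (antidiagonalSum-vanishing n earlierTerms)) ⟩
    antidiagonalSum n (λ i j → D i * E (suc j)) + D (suc n) * E 0
      ≡⟨ sym (antidiagonalSum-last n (λ i j → D i * E j)) ⟩
    (D ∗ E) (suc n)
      ≡⟨ DE≡0 (suc n) ⟩
    0ℤ ∎)
    where
    earlierTerms : ∀ i j → i ℕ.+ j ≡ n → D i * E (suc j) ≡ 0ℤ
    earlierTerms i j eq = cong (_* E (suc j)) (vanishesUpTo n i (m+n≤o⇒m≤o i (≤-reflexive eq)))

-- Square roots of 1 - 2x - 3x²

sqrt-unique : ∀ S T → S ∗ S ≗ T ∗ T → S 0 + T 0 ≢ 0ℤ → S ≗ T
sqrt-unique S T S²≗T² S0+T0≢0 n =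
  i-j≡0⇒i≡j (S n) (T n) (∗-noZeroDivisors (λ i → S i - T i) (λ j → S j + T j) S0+T0≢0 product≡0 n)
  where
  product≡0 : ∀ n → ((λ i → S i - T i) ∗ (λ j → S j + T j)) n ≡ 0ℤ
  product≡0 n = begin
    ((λ i → S i - T i) ∗ (λ j → S j + T j)) n ≡⟨ ∗-difference-of-squares S T n ⟩
    (S ∗ S) n - (T ∗ T) n                     ≡⟨ cong (λ c → c - (T ∗ T) n) (S²≗T² n) ⟩
    (T ∗ T) n - (T ∗ T) n                     ≡⟨ +-inverseʳ ((T ∗ T) n) ⟩
    0ℤ                                        ∎

IsMotzkinSeries : Series → Set
IsMotzkinSeries M = ∀ n → M n ≡ X· 𝟙 n + X· M n + X· (M ∗ M) n

root : Series → Series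
root M n = 𝟙 n - X· 𝟙 n - + 2 * X· M n

∗-root : ∀ f M n → (f ∗ root M) n ≡ f n - X· f n - + 2 * X· (f ∗ M) n
∗-root f M n = begin
  (f ∗ root M) n
    ≡⟨ ∗-distribˡ-- f (λ j → 𝟙 j - X· 𝟙 j) (λ j → + 2 * X· M j) n ⟩
  (f ∗ (λ j → 𝟙 j - X· 𝟙 j)) n - (f ∗ (λ j → + 2 * X· M j)) n
    ≡⟨ cong₂ _-_ (∗-distribˡ-- f 𝟙 (X· 𝟙) n) (∗-*ʳ f (+ 2) (X· M) n) ⟩
  ((f ∗ 𝟙) n - (f ∗ X· 𝟙) n) - + 2 * (f ∗ X· M) n
    ≡⟨ cong₂ (λ a b → a - b - + 2 * (f ∗ X· M) n)
             (∗-identityʳ f n) (trans (∗-X·ʳ f 𝟙 n) (X·-cong (∗-identityʳ f) n)) ⟩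
  f n - X· f n - + 2 * (f ∗ X· M) n
    ≡⟨ cong (λ c → f n - X· f n - + 2 * c) (∗-X·ʳ f M n) ⟩
  f n - X· f n - + 2 * X· (f ∗ M) n ∎

P-suc : ∀ n → P (suc n) ≡ - (+ 2) * 𝟙 n - + 3 * X· 𝟙 n
P-suc zero          = refl
P-suc (suc zero)    = refl
P-suc (suc (suc n)) = refl

-- (1 - x - 2xM)² - (1 - 2x - 3x²) = -4x (M - x - xM - xM²)
root-squared : ∀ M → IsMotzkinSeries M → root M ∗ root M ≗ P
root-squared M isMotzkin zero    = refl
root-squared M isMotzkin (suc n) = begin
  (A ∗ A) (suc n)
    ≡⟨ ∗-root A M (suc n) ⟩
  A (suc n) - A n - + 2 * (A ∗ M) n
    ≡⟨ cong (λ c → A (suc n) - A n - + 2 * c) (trans (∗-comm A M n) (∗-root M M n)) ⟩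
  expand (M n)
    ≡⟨ cong expand (isMotzkin n) ⟩
  expand (X· 𝟙 n + X· M n + X· (M ∗ M) n)
    ≡⟨ simplify (𝟙 n) (X· 𝟙 n) (X· M n) (X· (M ∗ M) n) ⟩
  - (+ 2) * 𝟙 n - + 3 * X· 𝟙 n
    ≡⟨ sym (P-suc n) ⟩
  P (suc n) ∎
  where
  A : Series
  A = root M
  expand : ℤ → ℤ
  expand m = (0ℤ - 𝟙 n - + 2 * m) - (𝟙 n - X· 𝟙 n - + 2 * X· M n)
           - + 2 * (m - X· M n - + 2 * X· (M ∗ M) n)
  simplify : ∀ e x y z →
    (0ℤ - e - + 2 * (x + y + z)) - (e - x - + 2 * y) - + 2 * ((x + y + z) - y - + 2 * z)
      ≡ - (+ 2) * e - + 3 * x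
  simplify = solve-∀

linear-recurrence⇒∗-root : ∀ F G M →
  (∀ n → F n ≡ G n + X· F n + + 2 * X· (F ∗ M) n) → F ∗ root M ≗ G
linear-recurrence⇒∗-root F G M recurrence n = begin
  (F ∗ root M) n
    ≡⟨ ∗-root F M n ⟩
  F n - X· F n - + 2 * X· (F ∗ M) n
    ≡⟨ cong (λ c → c - X· F n - + 2 * X· (F ∗ M) n) (recurrence n) ⟩
  (G n + X· F n + + 2 * X· (F ∗ M) n) - X· F n - + 2 * X· (F ∗ M) n
    ≡⟨ cancel (G n) (X· F n) (X· (F ∗ M) n) ⟩
  G n ∎
  where
  cancel : ∀ g a b → (g + a + + 2 * b) - a - + 2 * b ≡ g
  cancel = solve-∀

-- Sums over Motzkin trees of a given size

∑ : ∀ {A : Set} → List A → (A → ℤ) → ℤ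
∑ []       F = 0ℤ
∑ (x ∷ xs) F = F x + ∑ xs F

module _ {A : Set} where

  ∑-cong : ∀ (xs : List A) {F G : A → ℤ} → (∀ x → F x ≡ G x) → ∑ xs F ≡ ∑ xs G
  ∑-cong []       F≗G = refl
  ∑-cong (x ∷ xs) F≗G = cong₂ _+_ (F≗G x) (∑-cong xs F≗G)

  ∑-vanishing : ∀ (xs : List A) {F : A → ℤ} → (∀ x → F x ≡ 0ℤ) → ∑ xs F ≡ 0ℤ
  ∑-vanishing []       F≗0 = refl
  ∑-vanishing (x ∷ xs) F≗0 = cong₂ _+_ (F≗0 x) (∑-vanishing xs F≗0)

  ∑-++ : ∀ (xs ys : List A) F → ∑ (xs ++ ys) F ≡ ∑ xs F + ∑ ys F
  ∑-++ []       ys F = sym (+-identityˡ (∑ ys F))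
  ∑-++ (x ∷ xs) ys F = trans (cong (_+_ (F x)) (∑-++ xs ys F)) (sym (+-assoc (F x) (∑ xs F) (∑ ys F)))

  ∑-+ : ∀ (xs : List A) F G → ∑ xs (λ x → F x + G x) ≡ ∑ xs F + ∑ xs G
  ∑-+ []       F G = refl
  ∑-+ (x ∷ xs) F G =
    trans (cong (_+_ (F x + G x)) (∑-+ xs F G)) (+-interchange (F x) (G x) (∑ xs F) (∑ xs G))

  ∑-*ˡ : ∀ (xs : List A) c F → ∑ xs (λ x → c * F x) ≡ c * ∑ xs F
  ∑-*ˡ []       c F = sym (*-zeroʳ c)
  ∑-*ˡ (x ∷ xs) c F = trans (cong (_+_ (c * F x)) (∑-*ˡ xs c F)) (sym (*-distribˡ-+ c (F x) (∑ xs F)))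

  ∑-*ʳ : ∀ (xs : List A) c F → ∑ xs (λ x → F x * c) ≡ ∑ xs F * c
  ∑-*ʳ xs c F = trans (∑-cong xs (λ x → *-comm (F x) c)) (trans (∑-*ˡ xs c F) (*-comm c (∑ xs F)))

  ∑-antidiagonalSum : ∀ (xs : List A) n (h : A → ℕ → ℕ → ℤ) →
    ∑ xs (λ x → antidiagonalSum n (h x)) ≡ antidiagonalSum n (λ i j → ∑ xs (λ x → h x i j))
  ∑-antidiagonalSum []       n h = sym (antidiagonalSum-vanishing n (λ _ _ _ → refl))
  ∑-antidiagonalSum (x ∷ xs) n h =
    trans (cong (_+_ (antidiagonalSum n (h x))) (∑-antidiagonalSum xs n h))
          (sym (antidiagonalSum-+ n (h x) (λ i j → ∑ xs (λ y → h y i j))))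

  ∑-filter-≟ : ∀ (g : A → ℕ) m (xs : List A) F →
    ∑ (filter (λ x → g x ≟ m) xs) F ≡ ∑ xs (λ x → + ind (g x) m * F x)
  ∑-filter-≟ g m []       F = refl
  ∑-filter-≟ g m (x ∷ xs) F with does (g x ≟ m)
  ... | true  = cong₂ _+_ (sym (*-identityˡ (F x))) (∑-filter-≟ g m xs F)
  ... | false = trans (∑-filter-≟ g m xs F) (sym (+-identityˡ _))

  +-length : ∀ (xs : List A) → + length xs ≡ ∑ xs (λ _ → 1ℤ)
  +-length []       = refl
  +-length (x ∷ xs) = cong (_+_ 1ℤ) (+-length xs)

  +-sum-map : ∀ (f : A → ℕ) xs → + sum (map f xs) ≡ ∑ xs (λ x → + f x)
  +-sum-map f []       = refl
  +-sum-map f (x ∷ xs) = cong (_+_ (+ f x)) (+-sum-map f xs)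

module _ {A B : Set} where

  ∑-map : ∀ (g : B → A) xs F → ∑ (map g xs) F ≡ ∑ xs (F ∘ g)
  ∑-map g []       F = refl
  ∑-map g (x ∷ xs) F = cong (_+_ (F (g x))) (∑-map g xs F)

  ∑-concatMap : ∀ (g : B → List A) xs F → ∑ (concatMap g xs) F ≡ ∑ xs (λ x → ∑ (g x) F)
  ∑-concatMap g []       F = refl
  ∑-concatMap g (x ∷ xs) F =
    trans (∑-++ (g x) (concatMap g xs) F) (cong (_+_ (∑ (g x) F)) (∑-concatMap g xs F))

ind-+ : ∀ a b n → + ind (a ℕ.+ b) n ≡ antidiagonalSum n (λ i j → + ind a i * + ind b j)
ind-+ zero    b zero    = sym (*-identityˡ (+ ind b 0))
ind-+ (suc a) b zero    = refl
ind-+ zero    b (suc n) = begin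
  + ind b (suc n)        ≡⟨ sym (+-identityʳ _) ⟩
  + ind b (suc n) + 0ℤ   ≡⟨ cong₂ _+_ (sym (*-identityˡ (+ ind b (suc n))))
                                     (sym (antidiagonalSum-vanishing n (λ _ _ _ → refl))) ⟩
  antidiagonalSum (suc n) (λ i j → + ind 0 i * + ind b j) ∎
ind-+ (suc a) b (suc n) = trans (ind-+ a b n) (sym (+-identityˡ _))

sizeSum : List Motzkin → ℕ → (Motzkin → ℤ) → ℤ
sizeSum L n F = ∑ L (λ t → + ind (size t) n * F t)

treeSum : ℕ → (Motzkin → ℤ) → ℤ
treeSum n = sizeSum (treesOfHeight≤ n) n

sizeSum-cong : ∀ L n {F G} → (∀ t → F t ≡ G t) → sizeSum L n F ≡ sizeSum L n G
sizeSum-cong L n F≗G = ∑-cong L (λ t → cong (+ ind (size t) n *_) (F≗G t))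

sizeSum-zero : ∀ L F → sizeSum L 0 F ≡ 0ℤ
sizeSum-zero L F = ∑-vanishing L noTreeOfSizeZero
  where
  noTreeOfSizeZero : ∀ t → + ind (size t) 0 * F t ≡ 0ℤ
  noTreeOfSizeZero leaf         = refl
  noTreeOfSizeZero (unary t)    = refl
  noTreeOfSizeZero (binary l r) = refl

sizeSum-+ : ∀ L n F G → sizeSum L n (λ t → F t + G t) ≡ sizeSum L n F + sizeSum L n G
sizeSum-+ L n F G =
  trans (∑-cong L (λ t → *-distribˡ-+ (+ ind (size t) n) (F t) (G t)))
        (∑-+ L (λ t → + ind (size t) n * F t) (λ t → + ind (size t) n * G t))

sizeSum-*ʳ : ∀ L n F c → sizeSum L n (λ t → F t * c) ≡ sizeSum L n F * c
sizeSum-*ʳ L n F c =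
  trans (∑-cong L (λ t → sym (*-assoc (+ ind (size t) n) (F t) c)))
        (∑-*ʳ L c (λ t → + ind (size t) n * F t))

pairSum : List Motzkin → ℕ → (Motzkin → ℤ) → ℤ
pairSum L n F = antidiagonalSum n (λ i j → sizeSum L i (λ l → sizeSum L j (λ r → F (binary l r))))

sizeSum-binary : ∀ (L : List Motzkin) n (F : Motzkin → ℤ) →
  ∑ (concatMap (λ l → map (binary l) L) L) (λ t → + ind (size t) (suc n) * F t) ≡ pairSum L n F
sizeSum-binary L n F = begin
  ∑ (concatMap (λ l → map (binary l) L) L) φ
    ≡⟨ ∑-concatMap (λ l → map (binary l) L) L φ ⟩
  ∑ L (λ l → ∑ (map (binary l) L) φ)
    ≡⟨ ∑-cong L (λ l → trans (∑-map (binary l) L φ) (∑-cong L (splitSizes l))) ⟩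
  ∑ L (λ l → ∑ L (λ r → antidiagonalSum n (λ i j → χ l i * (χ r j * F (binary l r)))))
    ≡⟨ ∑-cong L (λ l → ∑-antidiagonalSum L n (λ r i j → χ l i * (χ r j * F (binary l r)))) ⟩
  ∑ L (λ l → antidiagonalSum n (λ i j → ∑ L (λ r → χ l i * (χ r j * F (binary l r)))))
    ≡⟨ ∑-cong L (λ l → antidiagonalSum-cong n (λ i j _ →
         ∑-*ˡ L (χ l i) (λ r → χ r j * F (binary l r)))) ⟩
  ∑ L (λ l → antidiagonalSum n (λ i j → χ l i * sizeSum L j (λ r → F (binary l r))))
    ≡⟨ ∑-antidiagonalSum L n (λ l i j → χ l i * sizeSum L j (λ r → F (binary l r))) ⟩
  pairSum L n F ∎
  where
  χ : Motzkin → ℕ → ℤ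
  χ t m = + ind (size t) m
  φ : Motzkin → ℤ
  φ t = χ t (suc n) * F t
  splitSizes : ∀ l r → φ (binary l r) ≡ antidiagonalSum n (λ i j → χ l i * (χ r j * F (binary l r)))
  splitSizes l r = begin
    + ind (size l ℕ.+ size r) n * F (binary l r)
      ≡⟨ cong (_* F (binary l r)) (ind-+ (size l) (size r) n) ⟩
    antidiagonalSum n (λ i j → χ l i * χ r j) * F (binary l r)
      ≡⟨ sym (antidiagonalSum-*ʳ n (F (binary l r)) (λ i j → χ l i * χ r j)) ⟩
    antidiagonalSum n (λ i j → χ l i * χ r j * F (binary l r))
      ≡⟨ antidiagonalSum-cong n (λ i j _ → *-assoc (χ l i) (χ r j) (F (binary l r))) ⟩
    antidiagonalSum n (λ i j → χ l i * (χ r j * F (binary l r))) ∎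

sizeSum-suc : ∀ d n F → sizeSum (treesOfHeight≤ (suc d)) (suc n) F ≡
  𝟙 n * F leaf + (sizeSum (treesOfHeight≤ d) n (F ∘ unary) + pairSum (treesOfHeight≤ d) n F)
sizeSum-suc d n F = cong (_+_ (𝟙 n * F leaf)) (begin
  ∑ (map unary T ++ concatMap (λ l → map (binary l) T) T) φ
    ≡⟨ ∑-++ (map unary T) (concatMap (λ l → map (binary l) T) T) φ ⟩
  ∑ (map unary T) φ + ∑ (concatMap (λ l → map (binary l) T) T) φ
    ≡⟨ cong₂ _+_ (∑-map unary T φ) (sizeSum-binary T n F) ⟩
  sizeSum T n (F ∘ unary) + pairSum T n F ∎)
  where
  T : List Motzkin
  T = treesOfHeight≤ d
  φ : Motzkin → ℤ
  φ t = + ind (size t) (suc n) * F t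

sizeSum-step : ∀ {n d} → n ≤ d → ∀ F →
  sizeSum (treesOfHeight≤ d) n F ≡ sizeSum (treesOfHeight≤ (suc d)) n F
sizeSum-step {zero}  {d}     _         F =
  trans (sizeSum-zero (treesOfHeight≤ d) F) (sym (sizeSum-zero (treesOfHeight≤ (suc d)) F))
sizeSum-step {suc n} {suc d} (s≤s n≤d) F = begin
  sizeSum (treesOfHeight≤ (suc d)) (suc n) F
    ≡⟨ sizeSum-suc d n F ⟩
  𝟙 n * F leaf + (sizeSum (treesOfHeight≤ d) n (F ∘ unary) + pairSum (treesOfHeight≤ d) n F)
    ≡⟨ cong (_+_ (𝟙 n * F leaf))
            (cong₂ _+_ (sizeSum-step n≤d (F ∘ unary)) (antidiagonalSum-cong n stepPairs)) ⟩
  𝟙 n * F leaf + (sizeSum (treesOfHeight≤ (suc d)) n (F ∘ unary) + pairSum (treesOfHeight≤ (suc d)) n F)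
    ≡⟨ sym (sizeSum-suc (suc d) n F) ⟩
  sizeSum (treesOfHeight≤ (suc (suc d))) (suc n) F ∎
  where
  T T′ : List Motzkin
  T  = treesOfHeight≤ d
  T′ = treesOfHeight≤ (suc d)
  stepPairs : ∀ i j → i ℕ.+ j ≡ n →
    sizeSum T i (λ l → sizeSum T j (λ r → F (binary l r)))
      ≡ sizeSum T′ i (λ l → sizeSum T′ j (λ r → F (binary l r)))
  stepPairs i j i+j≡n =
    trans (sizeSum-cong T i (λ l → sizeSum-step j≤d (λ r → F (binary l r))))
          (sizeSum-step i≤d (λ l → sizeSum T′ j (λ r → F (binary l r))))
    where
    i≤d : i ≤ d
    i≤d = ≤-trans (m+n≤o⇒m≤o i (≤-reflexive i+j≡n)) n≤d
    j≤d : j ≤ d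
    j≤d = ≤-trans (m+n≤o⇒n≤o i (≤-reflexive i+j≡n)) n≤d

sizeSum-treesOfHeight≤ : ∀ {n d} → n ≤ d → ∀ F → sizeSum (treesOfHeight≤ d) n F ≡ treeSum n F
sizeSum-treesOfHeight≤ n≤d = stable (≤⇒≤′ n≤d)
  where
  stable : ∀ {n d} → n ≤′ d → ∀ F → sizeSum (treesOfHeight≤ d) n F ≡ treeSum n F
  stable ≤′-refl        F = refl
  stable (≤′-step n≤′d) F = trans (sym (sizeSum-step (≤′⇒≤ n≤′d) F)) (stable n≤′d F)

treeSum-suc : ∀ n F → treeSum (suc n) F ≡
  𝟙 n * F leaf + (treeSum n (F ∘ unary)
    + antidiagonalSum n (λ i j → treeSum i (λ l → treeSum j (λ r → F (binary l r)))))
treeSum-suc n F =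
  trans (sizeSum-suc n n F)
        (cong (λ c → 𝟙 n * F leaf + (treeSum n (F ∘ unary) + c)) (antidiagonalSum-cong n shrink))
  where
  T : List Motzkin
  T = treesOfHeight≤ n
  shrink : ∀ i j → i ℕ.+ j ≡ n →
    sizeSum T i (λ l → sizeSum T j (λ r → F (binary l r)))
      ≡ treeSum i (λ l → treeSum j (λ r → F (binary l r)))
  shrink i j i+j≡n =
    trans (sizeSum-cong T i (λ l → sizeSum-treesOfHeight≤ j≤n (λ r → F (binary l r))))
          (sizeSum-treesOfHeight≤ i≤n (λ l → treeSum j (λ r → F (binary l r))))
    where
    i≤n : i ≤ n
    i≤n = m+n≤o⇒m≤o i (≤-reflexive i+j≡n)
    j≤n : j ≤ n
    j≤n = m+n≤o⇒n≤o i (≤-reflexive i+j≡n)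

treeSum-+ : ∀ n F G → treeSum n (λ t → F t + G t) ≡ treeSum n F + treeSum n G
treeSum-+ n = sizeSum-+ (treesOfHeight≤ n) n

motzkin : Series
motzkin n = treeSum n (λ _ → 1ℤ)

treeSum-const : ∀ n c → treeSum n (λ _ → c) ≡ c * motzkin n
treeSum-const n c = begin
  treeSum n (λ _ → c)        ≡⟨ sizeSum-cong (treesOfHeight≤ n) n (λ _ → sym (*-identityˡ c)) ⟩
  treeSum n (λ _ → 1ℤ * c)   ≡⟨ sizeSum-*ʳ (treesOfHeight≤ n) n (λ _ → 1ℤ) c ⟩
  motzkin n * c              ≡⟨ *-comm (motzkin n) c ⟩
  c * motzkin n              ∎

treeSum-pair : ∀ i j F G →
  treeSum i (λ l → treeSum j (λ r → F l + G r)) ≡ treeSum i F * motzkin j + treeSum j G * motzkin i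
treeSum-pair i j F G = begin
  treeSum i (λ l → treeSum j (λ r → F l + G r))
    ≡⟨ sizeSum-cong (treesOfHeight≤ i) i (λ l →
         trans (treeSum-+ j (λ _ → F l) G) (cong (_+ treeSum j G) (treeSum-const j (F l)))) ⟩
  treeSum i (λ l → F l * motzkin j + treeSum j G)
    ≡⟨ treeSum-+ i (λ l → F l * motzkin j) (λ _ → treeSum j G) ⟩
  treeSum i (λ l → F l * motzkin j) + treeSum i (λ _ → treeSum j G)
    ≡⟨ cong₂ _+_ (sizeSum-*ʳ (treesOfHeight≤ i) i F (motzkin j)) (treeSum-const i (treeSum j G)) ⟩
  treeSum i F * motzkin j + treeSum j G * motzkin i ∎

motzkin-isMotzkinSeries : IsMotzkinSeries motzkin
motzkin-isMotzkinSeries zero    = refl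
motzkin-isMotzkinSeries (suc n) = begin
  motzkin (suc n)
    ≡⟨ treeSum-suc n (λ _ → 1ℤ) ⟩
  𝟙 n * 1ℤ + (motzkin n + antidiagonalSum n (λ i j → treeSum i (λ _ → treeSum j (λ _ → 1ℤ))))
    ≡⟨ cong₂ (λ a b → a + (motzkin n + b)) (*-identityʳ (𝟙 n)) (antidiagonalSum-cong n productOfCounts) ⟩
  𝟙 n + (motzkin n + (motzkin ∗ motzkin) n)
    ≡⟨ sym (+-assoc (𝟙 n) (motzkin n) ((motzkin ∗ motzkin) n)) ⟩
  𝟙 n + motzkin n + (motzkin ∗ motzkin) n ∎
  where
  productOfCounts : ∀ i j → i ℕ.+ j ≡ n → treeSum i (λ _ → motzkin j) ≡ motzkin i * motzkin j
  productOfCounts i j _ = trans (treeSum-const i (motzkin j)) (*-comm (motzkin j) (motzkin i))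

V-treeSum : ∀ k n → V k n ≡ treeSum n (λ t → + countSub k t)
V-treeSum k n =
  trans (+-sum-map (countSub k) (treesOfSize n)) (∑-filter-≟ size n (treesOfHeight≤ n) (λ t → + countSub k t))

R-treeSum : ∀ k n → R k n ≡ treeSum n (λ t → + ind (size t) k)
R-treeSum k n = begin
  + length (filter (λ t → size t ≟ k) (treesOfSize n))
    ≡⟨ +-length (filter (λ t → size t ≟ k) (treesOfSize n)) ⟩
  ∑ (filter (λ t → size t ≟ k) (treesOfSize n)) (λ _ → 1ℤ)
    ≡⟨ ∑-filter-≟ size k (treesOfSize n) (λ _ → 1ℤ) ⟩
  ∑ (treesOfSize n) (λ t → + ind (size t) k * 1ℤ)
    ≡⟨ ∑-filter-≟ size n (treesOfHeight≤ n) (λ t → + ind (size t) k * 1ℤ) ⟩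
  treeSum n (λ t → + ind (size t) k * 1ℤ)
    ≡⟨ sizeSum-cong (treesOfHeight≤ n) n (λ t → *-identityʳ (+ ind (size t) k)) ⟩
  treeSum n (λ t → + ind (size t) k) ∎

countBelowRoot : ℕ → Motzkin → ℕ
countBelowRoot k leaf         = 0
countBelowRoot k (unary t)    = countSub k t
countBelowRoot k (binary l r) = countSub k l ℕ.+ countSub k r

countSub-split : ∀ k t → + countSub k t ≡ + ind (size t) k + + countBelowRoot k t
countSub-split k leaf         = sym (+-identityʳ (+ ind 1 k))
countSub-split k (unary t)    = refl
countSub-split k (binary l r) = refl

treeSum-countBelowRoot : ∀ k n →
  treeSum (suc n) (λ t → + countBelowRoot k t) ≡ V k n + + 2 * (V k ∗ motzkin) n
treeSum-countBelowRoot k n = begin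
  treeSum (suc n) (λ t → + countBelowRoot k t)
    ≡⟨ treeSum-suc n (λ t → + countBelowRoot k t) ⟩
  𝟙 n * 0ℤ + (treeSum n cs + antidiagonalSum n (λ i j → treeSum i (λ l → treeSum j (λ r → cs l + cs r))))
    ≡⟨ cong₂ _+_ (*-zeroʳ (𝟙 n))
             (cong₂ _+_ (sym (V-treeSum k n)) (antidiagonalSum-cong n pairs)) ⟩
  0ℤ + (V k n + antidiagonalSum n (λ i j → V k i * motzkin j + V k j * motzkin i))
    ≡⟨ cong (λ c → 0ℤ + (V k n + c))
            (antidiagonalSum-+ n (λ i j → V k i * motzkin j) (λ i j → V k j * motzkin i)) ⟩
  0ℤ + (V k n + ((V k ∗ motzkin) n + antidiagonalSum n (λ i j → V k j * motzkin i)))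
    ≡⟨ cong (λ c → 0ℤ + (V k n + ((V k ∗ motzkin) n + c)))
            (sym (antidiagonalSum-swap n (λ i j → V k i * motzkin j))) ⟩
  0ℤ + (V k n + ((V k ∗ motzkin) n + (V k ∗ motzkin) n))
    ≡⟨ collect (V k n) ((V k ∗ motzkin) n) ⟩
  V k n + + 2 * (V k ∗ motzkin) n ∎
  where
  cs : Motzkin → ℤ
  cs t = + countSub k t
  pairs : ∀ i j → i ℕ.+ j ≡ n →
    treeSum i (λ l → treeSum j (λ r → cs l + cs r)) ≡ V k i * motzkin j + V k j * motzkin i
  pairs i j _ = trans (treeSum-pair i j cs cs)
    (sym (cong₂ (λ a b → a * motzkin j + b * motzkin i) (V-treeSum k i) (V-treeSum k j)))
  collect : ∀ v w → 0ℤ + (v + (w + w)) ≡ v + + 2 * w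
  collect = solve-∀

V-recurrence : ∀ k n → V k n ≡ R k n + X· (V k) n + + 2 * X· (V k ∗ motzkin) n
V-recurrence k zero    = refl
V-recurrence k (suc n) = begin
  V k (suc n)
    ≡⟨ V-treeSum k (suc n) ⟩
  treeSum (suc n) (λ t → + countSub k t)
    ≡⟨ sizeSum-cong (treesOfHeight≤ (suc n)) (suc n) (countSub-split k) ⟩
  treeSum (suc n) (λ t → + ind (size t) k + + countBelowRoot k t)
    ≡⟨ treeSum-+ (suc n) (λ t → + ind (size t) k) (λ t → + countBelowRoot k t) ⟩
  treeSum (suc n) (λ t → + ind (size t) k) + treeSum (suc n) (λ t → + countBelowRoot k t)
    ≡⟨ cong₂ _+_ (sym (R-treeSum k (suc n))) (treeSum-countBelowRoot k n) ⟩
  R k (suc n) + (V k n + + 2 * (V k ∗ motzkin) n)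
    ≡⟨ sym (+-assoc (R k (suc n)) (V k n) (+ 2 * (V k ∗ motzkin) n)) ⟩
  R k (suc n) + V k n + + 2 * (V k ∗ motzkin) n ∎

mainTheorem1 : (k : ℕ) → k ≥ 1 →
    Σ Series IsSqrtP ×
    ((S : Series) → IsSqrtP S → ∀ n → (V k ⊛ S) n ≡ R k n)
mainTheorem1 k _ = (A , refl , λ n → trans (⊛≗∗ A A n) (A²≗P n)) , λ S (S0≡1 , S²≗P) n → begin
  (V k ⊛ S) n ≡⟨ ⊛≗∗ (V k) S n ⟩
  (V k ∗ S) n ≡⟨ ∗-congʳ (V k) (sqrt-unique S A (S²≗A² S S²≗P) (S0+A0≢0 S0≡1)) n ⟩
  (V k ∗ A) n ≡⟨ linear-recurrence⇒∗-root (V k) (R k) motzkin (V-recurrence k) n ⟩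
  R k n       ∎
  where
  A : Series
  A = root motzkin
  A²≗P : A ∗ A ≗ P
  A²≗P = root-squared motzkin motzkin-isMotzkinSeries
  S²≗A² : ∀ S → (∀ n → (S ⊛ S) n ≡ P n) → S ∗ S ≗ A ∗ A
  S²≗A² S S²≗P m = trans (sym (⊛≗∗ S S m)) (trans (S²≗P m) (sym (A²≗P m)))
  S0+A0≢0 : ∀ {s} → s ≡ 1ℤ → s + A 0 ≢ 0ℤ
  S0+A0≢0 refl ()
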